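{- Let $\mathcal{P}$ be an abstract $n$-polytope, let $\Phi$ be a flag of $\mathcal{P}$, and let $K\subseteq N:=\{0,\ldots,n-1\}$. Let $\Phi_K$ denote the set of faces of $\Phi$ whose ranks lie in $K$, and let $\bar{K}:=N\setminus K$. Suppose that for each $i\in\bar{K}$ there exists an automorphism $\rho_i$ of $\mathcal{P}$ with $\Phi\rho_i=\Phi^i$. Then the subgroup $\langle\rho_i\mid i\in\bar{K}\rangle$ of $\Gamma(\mathcal{P})$ acts transitively on the set of flags of $\mathcal{P}$ that contain $\Phi_K$.
   Context: An (abstract) polytope of rank $n$ ($n$-polytope) is a partially ordered set $\mathcal{P}$ with a strictly monotone rank function onto $\{ -1,0,\ldots,n\}$ such that: $\mathcal{P}$ has a unique least face (rank $-1$) and a unique greatest face (rank $n$); every maximal chain (flag) contains exactly $n+2$ faces, one of each rank; (diamond condition) whenever $F\le G$ with $F$ of rank $j-1$ and $G$ of rank $j+1$ ($0\le j\le n-1$) there are exactly two $j$-faces $H$ with $F\le H\le G$; and $\mathcal{P}$ is strongly flag-connected: any two flags $\Phi,\Psi$ can be joined by a finite sequence of flags, each containing $\Phi\cap\Psi$, in which successive flags differ in exactly one face. For a flag $\Phi$ and $i\in\{0,\ldots,n-1\}$, $\Phi^i$ denotes the unique flag that differs from $\Phi$ exactly in its face of rank $i$. An automorphism is an order-preserving bijection with order-preserving inverse; $\Gamma(\mathcal{P})$ is the automorphism group, acting on flags on the right. -}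

module Defs where

open import Level using (0ℓ)
open import Data.Nat using (ℕ; suc)
open import Data.Fin using (Fin; zero; suc; toℕ; inject₁; fromℕ)
open import Data.Fin.Subset using (Subset; _∈_; _∉_)
import Data.Fin as Fin
open import Data.Product using (Σ; ∃; _×_; _,_)
open import Data.Sum using (_⊎_)
open import Relation.Nullary using (¬_)
open import Relation.Binary.PropositionalEquality using (_≡_; _≢_)
open import Relation.Binary.Structures using (IsPartialOrder)

-- A ranked poset of rank n.  Ranks -1,0,...,n are encoded by Fin (n + 2):
-- the index r stands for the rank (toℕ r - 1).
record RankedPoset (n : ℕ) : Set₁ where
  field
    Face           : Set
    _≤_            : Face → Face → Set
    isPartialOrder : IsPartialOrder _≡_ _≤_
    rank           : Face → Fin (suc (suc n))

module _ {n : ℕ} (P : RankedPoset n) where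
  open RankedPoset P

  ι : Fin n → Fin (suc (suc n))
  ι i = suc (inject₁ i)

  IsChain : (Face → Set) → Set
  IsChain C = ∀ {x y} → C x → C y → (x ≤ y) ⊎ (y ≤ x)

  IsMaximalChain : (Face → Set) → Set
  IsMaximalChain C = IsChain C × (∀ G → (∀ {x} → C x → (x ≤ G) ⊎ (G ≤ x)) → C G)

  -- A flag: a chain containing exactly one face of each rank (-1,…,n),
  -- recorded as the rank-indexed family of its faces.  Under the polytope
  -- axioms these are exactly the maximal chains.
  record Flag : Set where
    field
      face    : Fin (suc (suc n)) → Face
      rank-ok : ∀ r → rank (face r) ≡ r
      chain   : ∀ r s → r Fin.≤ s → face r ≤ face s
  open Flag public

  _≈F_ : Flag → Flag → Set
  Φ ≈F Ψ = ∀ r → face Φ r ≡ face Ψ r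

  DifferExactlyAt : Fin (suc (suc n)) → Flag → Flag → Set
  DifferExactlyAt r Φ Ψ = (face Φ r ≢ face Ψ r) × (∀ s → s ≢ r → face Φ s ≡ face Ψ s)

  IsAdjacent : Fin n → Flag → Flag → Set
  IsAdjacent i Φ Ψ = DifferExactlyAt (ι i) Φ Ψ

  StronglyFlagConnected : Set
  StronglyFlagConnected =
    ∀ (Φ Ψ : Flag) → Σ ℕ λ k → Σ (Fin (suc k) → Flag) λ seq →
      (seq zero ≈F Φ) × (seq (fromℕ k) ≈F Ψ)
      × (∀ j r → face Φ r ≡ face Ψ r → face (seq j) r ≡ face Φ r)
      × (∀ (j : Fin k) → Σ (Fin (suc (suc n))) λ r →
            DifferExactlyAt r (seq (inject₁ j)) (seq (suc j)))

  _⇔′_ : Set → Set → Set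
  A ⇔′ B = (A → B) × (B → A)

  _<F_ : Face → Face → Set
  F <F G = (F ≤ G) × (F ≢ G)

  record IsPolytope : Set₁ where
    field
      rank-strict  : ∀ {F G} → F <F G → rank F Fin.< rank G
      rank-onto    : ∀ r → Σ Face λ F → rank F ≡ r
      least        : Σ Face λ F₀ → ∀ G → F₀ ≤ G
      greatest     : Σ Face λ Fₙ → ∀ G → G ≤ Fₙ
      maximal-chains : ∀ (C : Face → Set) → IsMaximalChain C →
        ∀ r → Σ Face λ F → C F × rank F ≡ r × (∀ G → C G → rank G ≡ r → G ≡ F)
      diamond : ∀ {F G} → F ≤ G → toℕ (rank G) ≡ suc (suc (toℕ (rank F))) →
        Σ Face λ H₁ → Σ Face λ H₂ → H₁ ≢ H₂ ×
          (∀ H → (F ≤ H × H ≤ G × toℕ (rank H) ≡ suc (toℕ (rank F)))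
               ⇔′ (H ≡ H₁ ⊎ H ≡ H₂))
      strongly-flag-connected : StronglyFlagConnected

  record Automorphism : Set where
    field
      fun      : Face → Face
      inv      : Face → Face
      inv-left  : ∀ F → inv (fun F) ≡ F
      inv-right : ∀ F → fun (inv F) ≡ F
      fun-mono : ∀ {F G} → F ≤ G → fun F ≤ fun G
      inv-mono : ∀ {F G} → F ≤ G → inv F ≤ inv G
  open Automorphism public

  MapsFlagTo : Automorphism → Flag → Flag → Set
  MapsFlagTo α Φ Ψ = ∀ r → fun α (face Φ r) ≡ face Ψ r

  -- elements of the subgroup generated by a family of automorphisms,
  -- as words in the generators and their inverses
  data Word {I : Set} (gen : I → Automorphism) : Set where
    ε    : Word gen
    g    : I → Word gen
    g⁻¹  : I → Word gen
    _·_  : Word gen → Word gen → Word gen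

  -- right action: Φ(w·v) = (Φw)v, so the face map of w·v is ⟦v⟧ ∘ ⟦w⟧
  ⟦_⟧ : ∀ {I} {gen : I → Automorphism} → Word gen → Face → Face
  ⟦_⟧ {gen = gen} ε F = F
  ⟦_⟧ {gen = gen} (g i) F = fun (gen i) F
  ⟦_⟧ {gen = gen} (g⁻¹ i) F = inv (gen i) F
  ⟦_⟧ {gen = gen} (w · v) F = ⟦ v ⟧ (⟦ w ⟧ F)

  ContainsPart : Subset n → Flag → Flag → Set
  ContainsPart K Φ Ψ = ∀ i → i ∈ K → face Ψ (ι i) ≡ face Φ (ι i)

-- Write Φw for the image of a flag Φ under a word w in the generators.  Since w
-- acts by an order-preserving injection, (Φ^i)w is a flag agreeing with Φw
-- except at rank i, where its face differs from that of Φw; by the diamond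
-- condition this forces (Φ^i)w = (Φw)^i.  Hence if Θ = Φw and i ∉ K then
-- Θ^i = (Φ^i)w = Φ(ρ_i w).  A flag Ψ containing Φ_K is joined to Φ by a chain
-- of adjacent flags all containing Φ_K; the least and greatest faces and the
-- faces in Φ_K are shared along it, so each step is an i-adjacency with i ∉ K,
-- and Ψ = Φw for a word w in the ρ_i.  Likewise Ψ′ = Φw′, so Ψ′ = Ψ(w⁻¹w′).
module Submission where

open import Defs
open import Data.Nat using (ℕ)
open import Data.Fin using (Fin)
open import Data.Fin.Subset using (Subset; _∈_; _∉_)
open import Data.Product using (Σ; ∃; _×_; _,_)
open import Relation.Binary.PropositionalEquality using (_≡_)

import Data.Nat as ℕ
import Data.Nat.Properties as ℕ
open import Data.Fin using (zero; suc; toℕ; inject₁; fromℕ; lower₁)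
import Data.Fin as Fin
open import Data.Fin.Properties using (toℕ-inject₁; toℕ≤pred[n]; ≤̄⇒inject₁<; ≤-refl; <⇒≢; inject₁-lower₁)
open import Data.Fin.Induction using (<-weakInduction)
open import Data.Product using (proj₁; proj₂; map; map₂)
open import Data.Sum using (_⊎_; inj₁; inj₂)
open import Data.Empty using (⊥-elim)
open import Relation.Nullary using (¬_; yes; no; contradiction)
open import Relation.Binary.PropositionalEquality using (_≢_; refl; sym; trans; cong; subst₂)
open import Relation.Binary.Structures using (IsPartialOrder)

one-of-two : ∀ {A : Set} {a b c x y : A} →
  c ≡ a ⊎ c ≡ b → x ≡ a ⊎ x ≡ b → y ≡ a ⊎ y ≡ b → c ≢ x → c ≢ y → x ≡ y
one-of-two _            (inj₁ refl) (inj₁ refl) _   _   = refl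
one-of-two _            (inj₂ refl) (inj₂ refl) _   _   = refl
one-of-two (inj₁ refl)  (inj₁ refl) (inj₂ refl) c≢x _   = contradiction refl c≢x
one-of-two (inj₂ refl)  (inj₂ refl) (inj₁ refl) c≢x _   = contradiction refl c≢x
one-of-two (inj₁ refl)  (inj₂ refl) (inj₁ refl) _   c≢y = contradiction refl c≢y
one-of-two (inj₂ refl)  (inj₁ refl) (inj₂ refl) _   c≢y = contradiction refl c≢y

¬≢-trans : ∀ {A : Set} {a b c : A} → ¬ a ≢ c → ¬ b ≢ c → ¬ a ≢ b
¬≢-trans ¬a≢c ¬b≢c a≢b = ¬a≢c λ a≡c → ¬b≢c λ b≡c → a≢b (trans a≡c (sym b≡c))

below above : ∀ {n} → Fin n → Fin (2 ℕ.+ n)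
below i = inject₁ (inject₁ i)
above i = suc (suc i)

module _ {n : ℕ} {P : RankedPoset n} {I : Set} {gen : I → Automorphism P} where
  open RankedPoset P

  infix 30 _⁻¹ʷ
  _⁻¹ʷ : Word P gen → Word P gen
  ε ⁻¹ʷ       = ε
  g i ⁻¹ʷ     = g⁻¹ i
  g⁻¹ i ⁻¹ʷ   = g i
  (w · v) ⁻¹ʷ = v ⁻¹ʷ · w ⁻¹ʷ

  ⟦⁻¹ʷ⟧-inverseˡ : ∀ (w : Word P gen) F → ⟦_⟧ P (w ⁻¹ʷ) (⟦_⟧ P w F) ≡ F
  ⟦⁻¹ʷ⟧-inverseˡ ε       F = refl
  ⟦⁻¹ʷ⟧-inverseˡ (g i)   F = inv-left (gen i) F
  ⟦⁻¹ʷ⟧-inverseˡ (g⁻¹ i) F = inv-right (gen i) F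
  ⟦⁻¹ʷ⟧-inverseˡ (w · v) F =
    trans (cong (⟦_⟧ P (w ⁻¹ʷ)) (⟦⁻¹ʷ⟧-inverseˡ v (⟦_⟧ P w F))) (⟦⁻¹ʷ⟧-inverseˡ w F)

  ⟦⟧-injective : ∀ (w : Word P gen) {F G} → ⟦_⟧ P w F ≡ ⟦_⟧ P w G → F ≡ G
  ⟦⟧-injective w {F} {G} wF≡wG =
    trans (sym (⟦⁻¹ʷ⟧-inverseˡ w F)) (trans (cong (⟦_⟧ P (w ⁻¹ʷ)) wF≡wG) (⟦⁻¹ʷ⟧-inverseˡ w G))

  ⟦⟧-mono : ∀ (w : Word P gen) {F G} → F ≤ G → ⟦_⟧ P w F ≤ ⟦_⟧ P w G
  ⟦⟧-mono ε       F≤G = F≤G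
  ⟦⟧-mono (g i)   F≤G = fun-mono (gen i) F≤G
  ⟦⟧-mono (g⁻¹ i) F≤G = inv-mono (gen i) F≤G
  ⟦⟧-mono (w · v) F≤G = ⟦⟧-mono v (⟦⟧-mono w F≤G)

  ⟦⟧-strictMono : ∀ (w : Word P gen) {F G} → _<F_ P F G → _<F_ P (⟦_⟧ P w F) (⟦_⟧ P w G)
  ⟦⟧-strictMono w (F≤G , F≢G) = ⟦⟧-mono w F≤G , λ wF≡wG → F≢G (⟦⟧-injective w wF≡wG)

  record MapsFlagToʷ (w : Word P gen) (Θ Θ′ : Flag P) : Set where
    constructor mapsFlagToʷ
    field maps-face : ∀ r → ⟦_⟧ P w (face Θ r) ≡ face Θ′ r
  open MapsFlagToʷ public

  mapsFlagToʷ-· : ∀ {w v Θ Θ′ Θ″} →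
    MapsFlagToʷ w Θ Θ′ → MapsFlagToʷ v Θ′ Θ″ → MapsFlagToʷ (w · v) Θ Θ″
  mapsFlagToʷ-· {v = v} (mapsFlagToʷ Θw≡Θ′) (mapsFlagToʷ Θ′v≡Θ″) =
    mapsFlagToʷ λ r → trans (cong (⟦_⟧ P v) (Θw≡Θ′ r)) (Θ′v≡Θ″ r)

  mapsFlagToʷ-⁻¹ : ∀ {w Θ Θ′} → MapsFlagToʷ w Θ Θ′ → MapsFlagToʷ (w ⁻¹ʷ) Θ′ Θ
  mapsFlagToʷ-⁻¹ {w} {Θ} (mapsFlagToʷ Θw≡Θ′) = mapsFlagToʷ λ r →
    trans (cong (⟦_⟧ P (w ⁻¹ʷ)) (sym (Θw≡Θ′ r))) (⟦⁻¹ʷ⟧-inverseˡ w (face Θ r))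

module _ {n : ℕ} {P : RankedPoset n} where
  open RankedPoset P

  flag-strict : ∀ (Θ : Flag P) {r s} → r Fin.< s → _<F_ P (face Θ r) (face Θ s)
  flag-strict Θ {r} {s} r<s =
    chain Θ r s (ℕ.<⇒≤ r<s) ,
    λ Θr≡Θs → <⇒≢ r<s (trans (sym (rank-ok Θ r)) (trans (cong rank Θr≡Θs) (rank-ok Θ s)))

  below<ι : ∀ i → below i Fin.< ι P i
  below<ι i = ≤̄⇒inject₁< ≤-refl

  ι<above : ∀ i → ι P i Fin.< above i
  ι<above i = ℕ.s≤s (≤̄⇒inject₁< ≤-refl)

  flag-around : ∀ (Θ : Flag P) i →
    _<F_ P (face Θ (below i)) (face Θ (ι P i)) × _<F_ P (face Θ (ι P i)) (face Θ (above i))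
  flag-around Θ i = flag-strict Θ (below<ι i) , flag-strict Θ (ι<above i)

  flag-rank-gap : ∀ (Θ : Flag P) i →
    toℕ (rank (face Θ (above i))) ≡ 2 ℕ.+ toℕ (rank (face Θ (below i)))
  flag-rank-gap Θ i
    rewrite rank-ok Θ (above i) | rank-ok Θ (below i) | toℕ-inject₁ (inject₁ i) | toℕ-inject₁ i
    = refl

module _ {n : ℕ} {P : RankedPoset n} (pol : IsPolytope P) where
  open RankedPoset P
  open IsPolytope pol
  open IsPartialOrder isPartialOrder using () renaming (trans to ≤-trans)

  Between : Face → Face → Face → Set
  Between A X B = _<F_ P A X × _<F_ P X B

  rank-between : ∀ {A X B} → Between A X B →
    toℕ (rank B) ≡ 2 ℕ.+ toℕ (rank A) → toℕ (rank X) ≡ ℕ.suc (toℕ (rank A))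
  rank-between {X = X} (A<X , X<B) gap =
    ℕ.≤-antisym (ℕ.s≤s⁻¹ (subst₂ ℕ._<_ refl gap (rank-strict X<B))) (rank-strict A<X)

  diamond-at-most-two : ∀ {A B C X Y} → toℕ (rank B) ≡ 2 ℕ.+ toℕ (rank A) →
    Between A C B → Between A X B → Between A Y B → C ≢ X → C ≢ Y → X ≡ Y
  diamond-at-most-two {A} {B} gap C∈AB@((A≤C , _) , (C≤B , _)) X∈AB Y∈AB
    with diamond (≤-trans A≤C C≤B) gap
  ... | H₁ , H₂ , _ , sides = one-of-two (classify C∈AB) (classify X∈AB) (classify Y∈AB)
    where
    classify : ∀ {Z} → Between A Z B → Z ≡ H₁ ⊎ Z ≡ H₂
    classify {Z} Z∈AB@((A≤Z , _) , (Z≤B , _)) =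
      proj₁ (sides Z) (A≤Z , Z≤B , rank-between Z∈AB gap)

  ⟦⟧-adjacent : ∀ {I} {gen : I → Automorphism P} (w : Word P gen) {i Φ Φⁱ Θ Θⁱ} →
    MapsFlagToʷ w Φ Θ → IsAdjacent P i Φ Φⁱ → IsAdjacent P i Θ Θⁱ → MapsFlagToʷ w Φⁱ Θⁱ
  ⟦⟧-adjacent w {i} {Φ} {Φⁱ} {Θ} {Θⁱ} (mapsFlagToʷ Φw≡Θ) (Φ≢Φⁱ , Φ≈Φⁱ) (Θ≢Θⁱ , Θ≈Θⁱ) =
    mapsFlagToʷ at
    where
    away : ∀ s → s ≢ ι P i → ⟦_⟧ P w (face Φⁱ s) ≡ face Θⁱ s
    away s s≢ι = trans (cong (⟦_⟧ P w) (sym (Φ≈Φⁱ s s≢ι))) (trans (Φw≡Θ s) (Θ≈Θⁱ s s≢ι))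

    below≢ι : below i ≢ ι P i
    below≢ι = <⇒≢ (below<ι {P = P} i)

    above≢ι : above i ≢ ι P i
    above≢ι above≡ι = <⇒≢ (ι<above {P = P} i) (sym above≡ι)

    Θ-between : Between (face Θⁱ (below i)) (face Θ (ι P i)) (face Θⁱ (above i))
    Θ-between = subst₂ (λ A B → Between A _ B) (Θ≈Θⁱ _ below≢ι) (Θ≈Θⁱ _ above≢ι)
                  (flag-around Θ i)

    Φⁱw-between : Between (face Θⁱ (below i)) (⟦_⟧ P w (face Φⁱ (ι P i))) (face Θⁱ (above i))
    Φⁱw-between = subst₂ (λ A B → Between A _ B) (away _ below≢ι) (away _ above≢ι)
                    (map (⟦⟧-strictMono w) (⟦⟧-strictMono w) (flag-around Φⁱ i))

    Θ≢Φⁱw : face Θ (ι P i) ≢ ⟦_⟧ P w (face Φⁱ (ι P i))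
    Θ≢Φⁱw Θ≡Φⁱw = Φ≢Φⁱ (⟦⟧-injective w (trans (Φw≡Θ (ι P i)) Θ≡Φⁱw))

    at : ∀ s → ⟦_⟧ P w (face Φⁱ s) ≡ face Θⁱ s
    at s with s Fin.≟ ι P i
    ... | no s≢ι   = away s s≢ι
    ... | yes refl = diamond-at-most-two (flag-rank-gap Θⁱ i)
                       Θ-between Φⁱw-between (flag-around Θⁱ i) Θ≢Φⁱw Θ≢Θⁱ

  -- Face equality is not decidable, so only ¬ _≢_ is available; that is enough
  -- to rule out flag steps at rank -1 or n.
  flags-share-bottom : ∀ (Θ Θ′ : Flag P) → ¬ face Θ zero ≢ face Θ′ zero
  flags-share-bottom Θ Θ′ = ¬≢-trans (is-least Θ) (is-least Θ′)
    where
    is-least : ∀ (Θ : Flag P) → ¬ face Θ zero ≢ proj₁ least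
    is-least Θ Θ₀≢F₀ = ℕ.n≮0 (subst₂ ℕ._<_ refl (cong toℕ (rank-ok Θ zero))
                         (rank-strict (proj₂ least (face Θ zero) , λ F₀≡Θ₀ → Θ₀≢F₀ (sym F₀≡Θ₀))))

  flags-share-top : ∀ (Θ Θ′ : Flag P) {r} → toℕ r ≡ ℕ.suc n → ¬ face Θ r ≢ face Θ′ r
  flags-share-top Θ Θ′ {r} r≡1+n = ¬≢-trans (is-greatest Θ) (is-greatest Θ′)
    where
    is-greatest : ∀ (Θ : Flag P) → ¬ face Θ r ≢ proj₁ greatest
    is-greatest Θ Θr≢Fₙ =
      ℕ.<⇒≱ (subst₂ ℕ._<_ (trans (cong toℕ (rank-ok Θ r)) r≡1+n) refl
               (rank-strict (proj₂ greatest (face Θ r) , Θr≢Fₙ)))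
            (toℕ≤pred[n] (rank (proj₁ greatest)))

  differing-rank-proper : ∀ (Θ Θ′ : Flag P) {r} → DifferExactlyAt P r Θ Θ′ → ∃ λ i → r ≡ ι P i
  differing-rank-proper Θ Θ′ {zero} (Θ≢Θ′ , _) = ⊥-elim (flags-share-bottom Θ Θ′ Θ≢Θ′)
  differing-rank-proper Θ Θ′ {suc r} (Θ≢Θ′ , _) with n ℕ.≟ toℕ r
  ... | yes n≡r = ⊥-elim (flags-share-top Θ Θ′ (cong ℕ.suc (sym n≡r)) Θ≢Θ′)
  ... | no n≢r  = lower₁ r n≢r , cong suc (sym (inject₁-lower₁ r n≢r))

module _ {n : ℕ} {P : RankedPoset n} (pol : IsPolytope P)
         {I : Set} {gen : I → Automorphism P} (Φ : Flag P) (K : Subset n)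
         (ρ-adjacent : ∀ i → i ∉ K → Σ I λ x → Σ (Flag P) λ Φⁱ →
                         IsAdjacent P i Φ Φⁱ × MapsFlagTo P (gen x) Φ Φⁱ) where
  open IsPolytope pol using (strongly-flag-connected)

  Reachable : Flag P → Set
  Reachable Θ = Σ (Word P gen) λ w → MapsFlagToʷ w Φ Θ

  reachable-adjacent : ∀ {i Θ Θⁱ} → i ∉ K → IsAdjacent P i Θ Θⁱ → Reachable Θ → Reachable Θⁱ
  reachable-adjacent {i} i∉K Θ~Θⁱ (w , Φw≡Θ) with ρ-adjacent i i∉K
  ... | x , Φⁱ , Φ~Φⁱ , Φx≡Φⁱ =
    g x · w ,
    mapsFlagToʷ-· (mapsFlagToʷ Φx≡Φⁱ) (⟦⟧-adjacent pol w {Φⁱ = Φⁱ} Φw≡Θ Φ~Φⁱ Θ~Θⁱ)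

  reachable : ∀ Ψ → ContainsPart P K Φ Ψ → Reachable Ψ
  reachable Ψ Ψ⊇Φ_K with strongly-flag-connected Φ Ψ
  ... | k , Θ , Θ₀≈Φ , Θₖ≈Ψ , Θ-keeps , Θ-steps =
    map₂ (λ Φw≡Θₖ → mapsFlagToʷ λ r → trans (maps-face Φw≡Θₖ r) (Θₖ≈Ψ r)) (reach (fromℕ k))
    where
    step : ∀ j → Reachable (Θ (inject₁ j)) → Reachable (Θ (suc j))
    step j with Θ-steps j
    ... | _ , differ with differing-rank-proper pol (Θ (inject₁ j)) (Θ (suc j)) differ
    ... | i , refl = reachable-adjacent i∉K differ
      where
      i∉K : i ∉ K
      i∉K i∈K = proj₁ differ (trans (Θ-keeps _ _ Φ≡Ψ) (sym (Θ-keeps _ _ Φ≡Ψ)))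
        where Φ≡Ψ = sym (Ψ⊇Φ_K i i∈K)

    reach : ∀ j → Reachable (Θ j)
    reach = <-weakInduction (λ j → Reachable (Θ j)) (ε , mapsFlagToʷ λ r → sym (Θ₀≈Φ r)) step

  flags-containing-part-transitive : ∀ Ψ Ψ′ → ContainsPart P K Φ Ψ → ContainsPart P K Φ Ψ′ →
    Σ (Word P gen) λ w → MapsFlagToʷ w Ψ Ψ′
  flags-containing-part-transitive Ψ Ψ′ Ψ⊇Φ_K Ψ′⊇Φ_K
    with reachable Ψ Ψ⊇Φ_K | reachable Ψ′ Ψ′⊇Φ_K
  ... | u , Φu≡Ψ | u′ , Φu′≡Ψ′ = u ⁻¹ʷ · u′ , mapsFlagToʷ-· (mapsFlagToʷ-⁻¹ Φu≡Ψ) Φu′≡Ψ′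

lemma1 : ∀ {n : ℕ} (P : RankedPoset n) → IsPolytope P →
    (Φ : Flag P) (K : Subset n) →
    (ρ : (i : Fin n) → i ∉ K → Automorphism P) →
    (∀ i (i∉K : i ∉ K) → Σ (Flag P) λ Φⁱ → IsAdjacent P i Φ Φⁱ × MapsFlagTo P (ρ i i∉K) Φ Φⁱ) →
    ∀ (Ψ Ψ′ : Flag P) → ContainsPart P K Φ Ψ → ContainsPart P K Φ Ψ′ →
      Σ (Word P {Σ (Fin n) λ i → i ∉ K} (λ { (i , i∉K) → ρ i i∉K })) λ w →
        ∀ r → ⟦_⟧ P w (face Ψ r) ≡ face Ψ′ r
lemma1 P pol Φ K ρ ρ-adjacent Ψ Ψ′ Ψ⊇Φ_K Ψ′⊇Φ_K =
  map₂ maps-face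
    (flags-containing-part-transitive pol Φ K (λ i i∉K → (i , i∉K) , ρ-adjacent i i∉K)
      Ψ Ψ′ Ψ⊇Φ_K Ψ′⊇Φ_K)
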